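{- For every integer $n \geq 2$, the number of star-generating digraphs on $n$ vertices with exactly one source, counted up to isomorphism, equals the number of integer partitions of $n-1$.
   Context: All digraphs are finite, may have loops (but no multiple arcs), and (standing assumption) every vertex has outdegree at least $1$. A vertex $y$ is a prey of $x$ (and $x$ a predator of $y$) if $(x,y)$ is an arc. A source is a vertex of indegree $0$. $D$ is weakly connected if its underlying undirected graph is connected. A weakly connected digraph $D$ is star-generating if: ($S_1$) $D$ has at least one source and, for each source $v$, each prey of $v$ has exactly two predators; ($S_2$) no two sources of $D$ have a common prey; ($S_3$) each non-source vertex has exactly one prey and exactly two predators, one of which is a source and the other of which is a non-source vertex. -}

module Defs where

open import Data.Nat using (ℕ; zero; suc; _+_; _≤_; _≥_; _≡ᵇ_)
open import Data.Bool using (Bool; true; false; if_then_else_)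
open import Data.Fin using (Fin; zero; suc)
open import Data.Fin.Permutation using (Permutation′; _⟨$⟩ʳ_)
open import Data.List using (List)
open import Data.Nat.ListAction using (sum)
open import Data.Empty using (⊥)
open import Data.List.Relation.Unary.All using (All)
open import Data.List.Relation.Unary.Linked using (Linked)
open import Data.Product using (Σ; _×_; ∃; ∃-syntax)
open import Relation.Binary.PropositionalEquality using (_≡_; _≢_)
open import Relation.Nullary using (¬_)

-- A digraph on vertex set Fin n (loops allowed, no multiple arcs):
-- D x y ≡ true  iff  (x , y) is an arc.
Digraph : ℕ → Set
Digraph n = Fin n → Fin n → Bool

Arc : ∀ {n} → Digraph n → Fin n → Fin n → Set
Arc D x y = D x y ≡ true

countF : ∀ {n} → (Fin n → Bool) → ℕ
countF {zero}  p = 0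
countF {suc n} p = (if p zero then 1 else 0) + countF (λ i → p (suc i))

outdeg : ∀ {n} → Digraph n → Fin n → ℕ
outdeg D x = countF (λ y → D x y)

indeg : ∀ {n} → Digraph n → Fin n → ℕ
indeg D y = countF (λ x → D x y)

IsSource : ∀ {n} → Digraph n → Fin n → Set
IsSource D v = indeg D v ≡ 0

numSources : ∀ {n} → Digraph n → ℕ
numSources D = countF (λ v → indeg D v ≡ᵇ 0)

OutdegPos : ∀ {n} → Digraph n → Set
OutdegPos D = ∀ x → 1 ≤ outdeg D x

data UConn {n} (D : Digraph n) : Fin n → Fin n → Set where
  here : ∀ {x} → UConn D x x
  fwd  : ∀ {x y z} → Arc D x y → UConn D y z → UConn D x z
  bwd  : ∀ {x y z} → Arc D y x → UConn D y z → UConn D x z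

WeaklyConnected : ∀ {n} → Digraph n → Set
WeaklyConnected D = ∀ x y → UConn D x y

S1 : ∀ {n} → Digraph n → Set
S1 D = (∃[ v ] IsSource D v)
     × (∀ v y → IsSource D v → Arc D v y → indeg D y ≡ 2)

S2 : ∀ {n} → Digraph n → Set
S2 D = ∀ u v y → IsSource D u → IsSource D v → u ≢ v
       → Arc D u y → Arc D v y → ⊥

S3 : ∀ {n} → Digraph n → Set
S3 D = ∀ x → ¬ IsSource D x
       → outdeg D x ≡ 1
       × indeg D x ≡ 2
       × (∃[ s ] ∃[ t ] (Arc D s x × IsSource D s × Arc D t x × ¬ IsSource D t))

StarGenerating : ∀ {n} → Digraph n → Set
StarGenerating D = OutdegPos D × WeaklyConnected D × S1 D × S2 D × S3 D

SG1 : ℕ → Set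
SG1 n = Σ (Digraph n) (λ D → StarGenerating D × numSources D ≡ 1)

Iso : ∀ {n} → Digraph n → Digraph n → Set
Iso {n} D E = Σ (Permutation′ n) (λ σ → ∀ x y → D x y ≡ E (σ ⟨$⟩ʳ x) (σ ⟨$⟩ʳ y))

record Partition (m : ℕ) : Set where
  field
    parts  : List ℕ
    pos    : All (1 ≤_) parts
    nonInc : Linked _≥_ parts
    total  : sum parts ≡ m
open Partition public

module Submission where

-- A one-source star-generating digraph on m + 1 vertices is its source, which points at all other
-- vertices, together with the functional graph of a permutation of the other m vertices: by (S3) each
-- of them has exactly one prey and exactly one predator besides the source. Every permutation of m
-- points arises in this way, from the cone over it, and an isomorphism of two cones fixes the apex, so
-- it is exactly a conjugacy of the permutations. Hence isomorphism classes correspond to conjugacy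
-- classes of permutations of m points, that is to cycle types, that is to partitions of m. A
-- permutation is conjugate to the standard permutation of its cycle type: label its orbits, split off
-- greedily longest first, by consecutive blocks of integers. Conversely the number of points of period
-- k is a conjugacy invariant, equal to k times the multiplicity of k in the cycle type.

open import Defs
open import Data.Bool using (Bool; true; false; if_then_else_; not; _∧_; _∨_)
open import Data.Bool.Properties using (∧-identityʳ; ∧-zeroʳ) renaming (_≟_ to _≟ᵇ_)
open import Data.Fin using (Fin; zero; suc; toℕ; fromℕ<; punchOut)
open import Data.Fin.Permutation
  using (Permutation′; _⟨$⟩ʳ_; _⟨$⟩ˡ_; permutation; inverseˡ; inverseʳ; remove; lift₀-remove)
open import Data.Fin.Properties
  using (any?; pigeonhole; punchOut-injective; injective⇒≤; toℕ<n; toℕ-fromℕ<; toℕ-injective)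
  renaming (_≟_ to _≟ᶠ_; suc-injective to sucᶠ-injective)
open import Data.List using (List; []; _∷_)
open import Data.List.Relation.Unary.All as All using (All; []; _∷_)
open import Data.List.Relation.Unary.Linked as Linked using (Linked; [-]; _∷_)
open import Data.List.Relation.Unary.Linked.Properties using (Linked⇒All)
import Data.Nat as ℕ
open import Data.Nat using (ℕ; zero; suc; _+_; _*_; _∸_; _≤_; _<_; _≥_; z≤n; s≤s; z<s; s≤s⁻¹; s<s⁻¹)
open import Data.Nat.GeneralisedArithmetic using (fold; fold-+)
open import Data.Nat.ListAction using (sum)
open import Data.Nat.Properties
open import Algebra.Properties.CommutativeMonoid.Sum +-0-commutativeMonoid using (sum-permute)
  renaming (sum to ∑)
open import Data.Product using (Σ; _×_; _,_; proj₁; proj₂; ∃-syntax)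
open import Data.Sum using (_⊎_; inj₁; inj₂)
open import Function using (_∘_; flip)
open import Function.Bundles using (mk⇔)
open import Function.Definitions using (Injective)
open import Relation.Binary.Definitions using (DecidableEquality; tri<; tri≈; tri>)
open import Relation.Binary.PropositionalEquality
open import Relation.Nullary using (¬_; Dec; yes; no; does; contradiction)
open import Relation.Nullary.Decidable using (dec-true; dec-false; does-⇔)

open ≡-Reasoning

_∖_ : ∀ {n} → (Fin n → Bool) → Fin n → Fin n → Bool
(p ∖ a) x = p x ∧ not (does (x ≟ᶠ a))

does-true⇒ : ∀ {A : Set} (a? : Dec A) → does a? ≡ true → A
does-true⇒ (yes a) _ = a

countF-cong : ∀ {n} {p q : Fin n → Bool} → (∀ x → p x ≡ q x) → countF p ≡ countF q
countF-cong {zero}          eq = refl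
countF-cong {suc n} {q = q} eq rewrite eq zero = cong ((if q zero then 1 else 0) +_) (countF-cong (eq ∘ suc))

countF-none : ∀ {n} {p : Fin n → Bool} → (∀ x → p x ≡ false) → countF p ≡ 0
countF-none {zero}  none = refl
countF-none {suc n} none rewrite none zero = countF-none (none ∘ suc)

countF-const-true : ∀ n → countF {n} (λ _ → true) ≡ n
countF-const-true zero    = refl
countF-const-true (suc n) = cong suc (countF-const-true n)

countF-remove : ∀ {n} (p : Fin n → Bool) {a} → p a ≡ true → countF p ≡ suc (countF (p ∖ a))
countF-remove {suc n} p {zero}  pa rewrite pa = cong suc (countF-cong λ x → sym (∧-identityʳ (p (suc x))))
countF-remove {suc n} p {suc a} pa rewrite countF-remove (p ∘ suc) pa | ∧-identityʳ (p zero) with p zero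
... | true  = refl
... | false = refl

countF≡0⇒ : ∀ {n} (p : Fin n → Bool) → countF p ≡ 0 → ∀ x → p x ≡ false
countF≡0⇒ p c x with p x in px
... | false = refl
... | true  with () ← trans (sym c) (countF-remove p px)

countF≡1⇒unique : ∀ {n} {p : Fin n → Bool} {a b} → countF p ≡ 1 → p a ≡ true → p b ≡ true → a ≡ b
countF≡1⇒unique {p = p} {a} {b} c pa pb with b ≟ᶠ a
... | yes b≡a = sym b≡a
... | no  b≢a = contradiction (trans (sym (countF≡0⇒ (p ∖ a) only-a b)) b∈p∖a) λ ()
  where
  only-a : countF (p ∖ a) ≡ 0
  only-a = suc-injective (trans (sym (countF-remove p pa)) c)
  b∈p∖a : (p ∖ a) b ≡ true
  b∈p∖a rewrite pb | dec-false (b ≟ᶠ a) b≢a = refl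

countF-single : ∀ {n} {p : Fin n → Bool} {a} → p a ≡ true → (∀ x → p x ≡ true → x ≡ a) → countF p ≡ 1
countF-single {p = p} {a} pa only = trans (countF-remove p pa) (cong suc (countF-none none))
  where
  none : ∀ x → (p ∖ a) x ≡ false
  none x with p x in px
  ... | false = refl
  ... | true  rewrite dec-true (x ≟ᶠ a) (only x px) = refl

countF-split : ∀ {n} (p q : Fin n → Bool) →
               countF p ≡ countF (λ x → p x ∧ q x) + countF (λ x → p x ∧ not (q x))
countF-split {zero}  p q = refl
countF-split {suc n} p q with p zero | q zero | countF-split (p ∘ suc) (q ∘ suc)
... | true  | true  | ih = cong suc ih
... | true  | false | ih = trans (cong suc ih) (sym (+-suc _ _))
... | false | true  | ih = ih
... | false | false | ih = ih

countF-permute : ∀ {n} (p : Fin n → Bool) (σ : Permutation′ n) → countF p ≡ countF (p ∘ (σ ⟨$⟩ʳ_))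
countF-permute p σ = trans (countF≡∑ p) (trans (sum-permute _ σ) (sym (countF≡∑ (p ∘ (σ ⟨$⟩ʳ_)))))
  where
  countF≡∑ : ∀ {n} (p : Fin n → Bool) → countF p ≡ ∑ (λ i → if p i then 1 else 0)
  countF≡∑ {zero}  p = refl
  countF≡∑ {suc n} p = cong ((if p zero then 1 else 0) +_) (countF≡∑ (p ∘ suc))

countBelow : ℕ → (ℕ → Bool) → ℕ
countBelow n g = countF {n} (g ∘ toℕ)

countBelow-+ : ∀ a {b} g → countBelow (a + b) g ≡ countBelow a g + countBelow b (g ∘ (a +_))
countBelow-+ zero    g = refl
countBelow-+ (suc a) g = trans (cong ((if g 0 then 1 else 0) +_) (countBelow-+ a (g ∘ suc)))
                               (sym (+-assoc (if g 0 then 1 else 0) _ _))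

countBelow-constant : ∀ n {g : ℕ → Bool} {c} → (∀ {i} → i < n → g i ≡ c) →
                      countBelow n g ≡ (if c then n else 0)
countBelow-constant n {c = c} const = trans (countF-cong (λ x → const (toℕ<n x))) (constant c)
  where
  constant : ∀ c → countF {n} (λ _ → c) ≡ (if c then n else 0)
  constant true  = countF-const-true n
  constant false = countF-none {n} (λ _ → refl)

argmax : ∀ {n} (p : Fin n → Bool) (f : Fin n → ℕ) →
         (∀ x → p x ≡ false) ⊎ ∃[ x ] p x ≡ true × (∀ y → p y ≡ true → f y ≤ f x)
argmax {zero}  p f = inj₁ λ ()
argmax {suc n} p f with argmax (p ∘ suc) (f ∘ suc) | p zero in p0
... | inj₁ none           | false = inj₁ λ { zero → p0 ; (suc x) → none x }
... | inj₁ none           | true  =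
  inj₂ (zero , p0 , λ { zero _ → ≤-refl ; (suc y) py → contradiction (trans (sym py) (none y)) λ () })
... | inj₂ (x , px , max) | false =
  inj₂ (suc x , px , λ { zero p0′ → contradiction (trans (sym p0) p0′) λ () ; (suc y) py → max y py })
... | inj₂ (x , px , max) | true  with f zero ≤? f (suc x)
...   | yes f0≤ = inj₂ (suc x , px , λ { zero _ → f0≤ ; (suc y) py → max y py })
...   | no  f0≰ = inj₂ (zero , p0 , λ { zero _ → ≤-refl ; (suc y) py → ≤-trans (max y py) (<⇒≤ (≰⇒> f0≰)) })

injective⇒surjective : ∀ {n} {f : Fin n → Fin n} → Injective _≡_ _≡_ f → ∀ y → ∃[ x ] f x ≡ y
injective⇒surjective {suc n} {f} f-inj y with any? (λ x → f x ≟ᶠ y)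
... | yes hit = hit
... | no miss = contradiction (injective⇒≤ {f = λ x → punchOut (avoid x)}
                                (f-inj ∘ punchOut-injective (avoid _) (avoid _))) 1+n≰n
  where
  avoid : ∀ x → y ≢ f x
  avoid x y≡fx = miss (x , sym y≡fx)

injective⇒permutation : ∀ {n} {f : Fin n → Fin n} → Injective _≡_ _≡_ f →
                        Σ (Permutation′ n) (λ σ → ∀ x → σ ⟨$⟩ʳ x ≡ f x)
injective⇒permutation {f = f} f-inj =
  permutation f (proj₁ ∘ surj) (proj₂ ∘ surj) (λ x → f-inj (proj₂ (surj (f x)))) , λ _ → refl
  where surj = injective⇒surjective f-inj

_^_ : {A : Set} → (A → A) → ℕ → A → A
(f ^ k) x = fold x f k

^-+ : ∀ {A : Set} (f : A → A) a b x → (f ^ (a + b)) x ≡ (f ^ a) ((f ^ b) x)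
^-+ f a b x = fold-+ x f a

^-conj : ∀ {A B : Set} {f : A → A} {g : B → B} {h : A → B} → (∀ x → h (f x) ≡ g (h x)) →
         ∀ k x → h ((f ^ k) x) ≡ (g ^ k) (h x)
^-conj         conj zero    x = refl
^-conj {g = g} conj (suc k) x = trans (conj _) (cong g (^-conj conj k x))

^-injective : ∀ {A : Set} {f : A → A} → Injective _≡_ _≡_ f → ∀ k → Injective _≡_ _≡_ (f ^ k)
^-injective f-inj zero    eq = eq
^-injective f-inj (suc k) eq = ^-injective f-inj k (f-inj eq)

InjectiveBelow : {A : Set} → ℕ → (ℕ → A) → Set
InjectiveBelow k f = ∀ {i j} → i < k → j < k → f i ≡ f j → i ≡ j

firstTrue : (ℕ → Bool) → ℕ → ℕ
firstTrue P zero    = zero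
firstTrue P (suc n) = if P 0 then 0 else suc (firstTrue (P ∘ suc) n)

firstTrue-cong : ∀ {P Q : ℕ → Bool} → (∀ i → P i ≡ Q i) → ∀ n → firstTrue P n ≡ firstTrue Q n
firstTrue-cong eq zero    = refl
firstTrue-cong eq (suc n) rewrite eq 0 | firstTrue-cong (eq ∘ suc) n = refl

firstTrue-least : ∀ {P : ℕ → Bool} {n k} → k < n → P k ≡ true → (∀ {i} → i < k → P i ≡ false) →
                  firstTrue P n ≡ k
firstTrue-least {k = zero}  (s≤s _)   Pk _      rewrite Pk = refl
firstTrue-least {k = suc k} (s≤s k<n) Pk before rewrite before z<s =
  cong suc (firstTrue-least k<n Pk (before ∘ s≤s))

firstTrue-spec : ∀ {P : ℕ → Bool} {n k} → k < n → P k ≡ true →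
                 firstTrue P n < n × P (firstTrue P n) ≡ true × (∀ {i} → i < firstTrue P n → P i ≡ false)
firstTrue-spec {P} {suc n} {k} k<n Pk with P 0 in P0 | k
... | true  | _      = z<s , P0 , λ ()
... | false | zero   = contradiction (trans (sym P0) Pk) λ ()
... | false | suc k′ with firstTrue-spec {P ∘ suc} (≤-trans (s≤s ≤-refl) (s<s⁻¹ k<n)) Pk
...   | lt , hit , before = s≤s lt , hit , λ { {zero} _ → P0 ; {suc i} (s≤s i<) → before i< }

record MinimalPeriod {A : Set} (f : A → A) (x : A) (l : ℕ) : Set where
  field
    positive : 1 ≤ l
    returns  : (f ^ l) x ≡ x
    minimal  : ∀ {j} → 1 ≤ j → j < l → (f ^ j) x ≢ x

minimalPeriod-cong : ∀ {A : Set} {f g : A → A} {x l} → (∀ j → (f ^ j) x ≡ (g ^ j) x) →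
                     MinimalPeriod g x l → MinimalPeriod f x l
minimalPeriod-cong {l = l} same mp = record
  { positive = positive
  ; returns  = trans (same l) returns
  ; minimal  = λ {j} 1≤j j<l back → minimal 1≤j j<l (trans (sym (same j)) back)
  }
  where open MinimalPeriod mp

orbit-distinct : ∀ {A : Set} {f : A → A} {x l i j} → Injective _≡_ _≡_ f → MinimalPeriod f x l →
                 i < j → j < l → (f ^ i) x ≢ (f ^ j) x
orbit-distinct {f = f} {x} {i = i} {j} f-inj mp i<j j<l fix with d , i+d≡j ← m≤n⇒∃[o]m+o≡n i<j =
  MinimalPeriod.minimal mp (s≤s z≤n) (≤-<-trans (s≤s (m≤n+m d i)) (subst (_< _) (sym i+d≡j) j<l))
    (^-injective f-inj i (begin
      (f ^ i) ((f ^ suc d) x)  ≡⟨ ^-+ f i (suc d) x ⟨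
      (f ^ (i + suc d)) x      ≡⟨ cong (λ e → (f ^ e) x) (trans (+-suc i d) i+d≡j) ⟩
      (f ^ j) x                ≡⟨ fix ⟨
      (f ^ i) x                ∎))

orbit-injective : ∀ {A : Set} {f : A → A} {x l} → Injective _≡_ _≡_ f → MinimalPeriod f x l →
                  InjectiveBelow l (λ i → (f ^ i) x)
orbit-injective f-inj mp {i} {j} i<l j<l eq with <-cmp i j
... | tri< i<j _ _ = contradiction eq (orbit-distinct f-inj mp i<j j<l)
... | tri≈ _ i≡j _ = i≡j
... | tri> _ _ j<i = contradiction (sym eq) (orbit-distinct f-inj mp j<i i<l)

module _ {A : Set} (_≟_ : DecidableEquality A) where

  -- The least k ∈ [1, bound] with (f ^ k) x ≡ x, or bound + 1 if there is none.
  period : ℕ → (A → A) → A → ℕ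
  period bound f x = suc (firstTrue (λ i → does ((f ^ suc i) x ≟ x)) bound)

  period-unique : ∀ {bound f x l} → MinimalPeriod f x l → l ≤ bound → period bound f x ≡ l
  period-unique {l = suc l} mp l≤bound = cong suc (firstTrue-least l≤bound
    (dec-true (_ ≟ _) (MinimalPeriod.returns mp))
    (λ i<l → dec-false (_ ≟ _) (MinimalPeriod.minimal mp (s≤s z≤n) (s≤s i<l))))

period-conj : ∀ {A B : Set} (_≟ᴬ_ : DecidableEquality A) (_≟ᴮ_ : DecidableEquality B)
              {f : A → A} {g : B → B} {h : A → B} → Injective _≡_ _≡_ h → (∀ x → h (f x) ≡ g (h x)) →
              ∀ bound x → period _≟ᴮ_ bound g (h x) ≡ period _≟ᴬ_ bound f x
period-conj _≟ᴬ_ _≟ᴮ_ {f} {g} {h} h-inj conj bound x = cong suc (firstTrue-cong same bound)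
  where
  same : ∀ i → does ((g ^ suc i) (h x) ≟ᴮ h x) ≡ does ((f ^ suc i) x ≟ᴬ x)
  same i = trans (cong (λ y → does (y ≟ᴮ h x)) (sym (^-conj {f = f} {g} {h} conj (suc i) x)))
                 (does-⇔ (mk⇔ h-inj (cong h)) (h ((f ^ suc i) x) ≟ᴮ h x) ((f ^ suc i) x ≟ᴬ x))

module _ {m : ℕ} {π : Fin m → Fin m} (π-inj : Injective _≡_ _≡_ π) where

  returns-within : ∀ x → ∃[ k ] k < m × (π ^ suc k) x ≡ x
  returns-within x with pigeonhole (n<1+n m) (λ (i : Fin (suc m)) → (π ^ toℕ i) x)
  ... | i , j , i<j , same with m≤n⇒∃[o]m+o≡n i<j
  ...   | k , i+k<j = k , k<m , ^-injective π-inj (toℕ i) (begin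
      (π ^ toℕ i) ((π ^ suc k) x)  ≡⟨ ^-+ π (toℕ i) (suc k) x ⟨
      (π ^ (toℕ i + suc k)) x      ≡⟨ cong (λ e → (π ^ e) x) (trans (+-suc (toℕ i) k) i+k<j) ⟩
      (π ^ toℕ j) x                ≡⟨ same ⟨
      (π ^ toℕ i) x                ∎)
    where
    k<m : k < m
    k<m = <-≤-trans (s≤s (m≤n+m k (toℕ i))) (s≤s⁻¹ (subst (_< suc m) (sym i+k<j) (toℕ<n j)))

  period-spec : ∀ x → MinimalPeriod π x (period _≟ᶠ_ m π x) × period _≟ᶠ_ m π x ≤ m
  period-spec x with returns-within x
  ... | k , k<m , ret with firstTrue-spec k<m (dec-true (_ ≟ᶠ x) ret)
  ...   | lt , hit , before = record
    { positive = s≤s z≤n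
    ; returns  = does-true⇒ (_ ≟ᶠ x) hit
    ; minimal  = λ { {suc j} _ (s≤s j<) ret′ →
                     contradiction (trans (sym (dec-true (_ ≟ᶠ x) ret′)) (before j<)) λ () }
    } , lt

-- The standard permutation of a given cycle type

data Cut (k : ℕ) : ℕ → Set where
  before : ∀ {i} → i < k → Cut k i
  after  : ∀ t → Cut k (k + t)

cut : ∀ k i → Cut k i
cut zero    i       = after i
cut (suc k) zero    = before z<s
cut (suc k) (suc i) with cut k i
... | before i<k = before (s≤s i<k)
... | after t    = after t

_++[_]_ : {A : Set} → (ℕ → A) → ℕ → (ℕ → A) → ℕ → A
(f ++[ zero  ] g) i       = g i
(f ++[ suc k ] g) zero    = f zero
(f ++[ suc k ] g) (suc i) = ((f ∘ suc) ++[ k ] g) i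

++-before : ∀ {A : Set} {f g : ℕ → A} {k i} → i < k → (f ++[ k ] g) i ≡ f i
++-before {k = suc k} {zero}  _         = refl
++-before {k = suc k} {suc i} (s≤s i<k) = ++-before i<k

++-after : ∀ {A : Set} {f g : ℕ → A} k t → (f ++[ k ] g) (k + t) ≡ g t
++-after zero    t = refl
++-after (suc k) t = ++-after k t

++-injective : ∀ {A : Set} {f g : ℕ → A} {k n} → InjectiveBelow k f → InjectiveBelow n g →
               (∀ {i j} → i < k → j < n → f i ≢ g j) → InjectiveBelow (k + n) (f ++[ k ] g)
++-injective {f = f} {g} {k} f-inj g-inj disjoint {i} {j} i< j< eq with cut k i | cut k j
... | before i<k | before j<k =
  f-inj i<k j<k (trans (sym (++-before i<k)) (trans eq (++-before j<k)))
... | before i<k | after u    =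
  contradiction (trans (sym (++-before i<k)) (trans eq (++-after k u))) (disjoint i<k (+-cancelˡ-< k u _ j<))
... | after t    | before j<k =
  contradiction (trans (sym (++-before j<k)) (trans (sym eq) (++-after k t))) (disjoint j<k (+-cancelˡ-< k t _ i<))
... | after t    | after u    =
  cong (k +_) (g-inj (+-cancelˡ-< k t _ i<) (+-cancelˡ-< k u _ j<)
                     (trans (sym (++-after k t)) (trans eq (++-after k u))))

rotate : ℕ → ℕ → ℕ
rotate zero    r = r
rotate (suc l) = suc ++[ l ] λ _ → 0

rotate-step : ∀ {l i} → suc i < l → rotate l i ≡ suc i
rotate-step {suc l} (s≤s i<l) = ++-before i<l

rotate-last : ∀ {l i} → suc i ≡ l → rotate l i ≡ 0
rotate-last {i = i} refl = trans (cong (suc ++[ i ] λ _ → 0) (sym (+-identityʳ i))) (++-after i 0)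

rotate-below : ∀ {l r} → r < l → rotate l r < l
rotate-below {suc l} {r} r<l with m≤n⇒m<n∨m≡n r<l
... | inj₁ 1+r<l = subst (_< suc l) (sym (rotate-step 1+r<l)) 1+r<l
... | inj₂ 1+r≡l = subst (_< suc l) (sym (rotate-last 1+r≡l)) z<s

rotate-injective : ∀ l → InjectiveBelow l (rotate l)
rotate-injective zero    i<0 = contradiction i<0 λ ()
rotate-injective (suc l) = subst (λ n → InjectiveBelow n (rotate (suc l))) (+-comm l 1)
  (++-injective {f = suc} {g = λ _ → 0} {k = l} {n = 1}
    (λ _ _ → suc-injective) (λ { (s≤s z≤n) (s≤s z≤n) _ → refl }) λ _ _ ())

rotate-from-0 : ∀ {l j} → j < l → (rotate l ^ j) 0 ≡ j
rotate-from-0         {j = zero}  _     = refl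
rotate-from-0 {suc l} {j = suc j} 1+j<l = trans (cong (rotate (suc l)) (rotate-from-0 (<-trans (n<1+n j) 1+j<l)))
                                                (rotate-step 1+j<l)

rotate-periodic : ∀ l t → (rotate l ^ (l + t)) 0 ≡ (rotate l ^ t) 0
rotate-periodic zero    t = refl
rotate-periodic (suc l) t = begin
  (rot ^ (suc l + t)) 0          ≡⟨ cong (λ e → (rot ^ e) 0) (+-comm (suc l) t) ⟩
  (rot ^ (t + suc l)) 0          ≡⟨ ^-+ rot t (suc l) 0 ⟩
  (rot ^ t) (rot ((rot ^ l) 0))  ≡⟨ cong ((rot ^ t) ∘ rot) (rotate-from-0 (n<1+n l)) ⟩
  (rot ^ t) (rot l)              ≡⟨ cong (rot ^ t) (rotate-last {i = l} refl) ⟩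
  (rot ^ t) 0                    ∎
  where rot = rotate (suc l)

rotate-minimalPeriod : ∀ {l r} → r < l → MinimalPeriod (rotate l) r l
rotate-minimalPeriod {l} {r} r<l = record
  { positive = ≤-trans (s≤s z≤n) r<l
  ; returns  = begin
      (rotate l ^ l) r        ≡⟨ from-0 l ⟩
      (rotate l ^ (l + r)) 0  ≡⟨ rotate-periodic l r ⟩
      (rotate l ^ r) 0        ≡⟨ rotate-from-0 r<l ⟩
      r                       ∎
  ; minimal  = minimal
  }
  where
  from-0 : ∀ j → (rotate l ^ j) r ≡ (rotate l ^ (j + r)) 0
  from-0 j = trans (cong (rotate l ^ j) (sym (rotate-from-0 r<l))) (sym (^-+ (rotate l) j r 0))
  minimal : ∀ {j} → 1 ≤ j → j < l → (rotate l ^ j) r ≢ r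
  minimal {j} 1≤j j<l back with j + r in j+r≡s
  ... | s with cut l s | trans (sym back) (trans (from-0 j) (cong (λ e → (rotate l ^ e) 0) j+r≡s))
  ...   | before s<l | r≡ = <-irrefl (trans (trans r≡ (rotate-from-0 s<l)) (sym j+r≡s)) (m<n+m r 1≤j)
  ...   | after t    | r≡ = <-irrefl (+-cancelʳ-≡ r j l (trans j+r≡s (cong (l +_) (sym r≡t)))) j<l
    where
    t<r : t < r
    t<r = +-cancelˡ-< l t r (subst (_< l + r) j+r≡s (+-monoˡ-< r j<l))
    r≡t : r ≡ t
    r≡t = trans r≡ (trans (rotate-periodic l t) (rotate-from-0 (<-trans t<r r<l)))

rotate-^-below : ∀ {l r} → r < l → ∀ j → (rotate l ^ j) r < l
rotate-^-below r<l zero    = r<l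
rotate-^-below r<l (suc j) = rotate-below (rotate-^-below r<l j)

-- canonical L rotates each of the consecutive blocks of ℕ of the lengths in L, and fixes all i ≥ sum L.
canonical : List ℕ → ℕ → ℕ
canonical []      i = i
canonical (l ∷ L) = rotate l ++[ l ] λ t → l + canonical L t

canonical-head : ∀ {l i} L → i < l → canonical (l ∷ L) i ≡ rotate l i
canonical-head L = ++-before

canonical-tail : ∀ l L t → canonical (l ∷ L) (l + t) ≡ l + canonical L t
canonical-tail l L = ++-after l

canonical-below : ∀ L {i} → i < sum L → canonical L i < sum L
canonical-below (l ∷ L) {i} i< with cut l i
... | before i<l = subst (_< l + sum L) (sym (canonical-head L i<l))
                         (≤-trans (rotate-below i<l) (m≤m+n l (sum L)))
... | after t    = subst (_< l + sum L) (sym (canonical-tail l L t))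
                         (+-monoʳ-< l (canonical-below L (+-cancelˡ-< l t _ i<)))

canonical-injective : ∀ L → InjectiveBelow (sum L) (canonical L)
canonical-injective []      ()
canonical-injective (l ∷ L) = ++-injective (rotate-injective l)
  (λ i< j< eq → canonical-injective L i< j< (+-cancelˡ-≡ l _ _ eq))
  (λ i<l _ eq → <-irrefl eq (≤-trans (rotate-below i<l) (m≤m+n l _)))

canonical-^-head : ∀ {l r} L → r < l → ∀ j → (canonical (l ∷ L) ^ j) r ≡ (rotate l ^ j) r
canonical-^-head L r<l zero    = refl
canonical-^-head L r<l (suc j) rewrite canonical-^-head L r<l j = canonical-head L (rotate-^-below r<l j)

canonical-period-head : ∀ {B l r} L → r < l → l ≤ B → period ℕ._≟_ B (canonical (l ∷ L)) r ≡ l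
canonical-period-head L r<l l≤B =
  period-unique ℕ._≟_ (minimalPeriod-cong (canonical-^-head L r<l) (rotate-minimalPeriod r<l)) l≤B

canonical-period-tail : ∀ B l L t →
                        period ℕ._≟_ B (canonical (l ∷ L)) (l + t) ≡ period ℕ._≟_ B (canonical L) t
canonical-period-tail B l L t =
  period-conj ℕ._≟_ ℕ._≟_ {f = canonical L} {canonical (l ∷ L)} {l +_}
              (+-cancelˡ-≡ l _ _) (λ u → sym (canonical-tail l L u)) B t

multiplicity : ℕ → List ℕ → ℕ
multiplicity k []      = 0
multiplicity k (l ∷ L) = (if does (l ℕ.≟ k) then 1 else 0) + multiplicity k L

canonical-period-count : ∀ {B} k L → All (_≤ B) L →
  countBelow (sum L) (λ j → does (period ℕ._≟_ B (canonical L) j ℕ.≟ k)) ≡ k * multiplicity k L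
canonical-period-count     k []      []          = sym (*-zeroʳ k)
canonical-period-count {B} k (l ∷ L) (l≤B ∷ L≤B) = begin
  countBelow (l + sum L) (periodIs (l ∷ L))
    ≡⟨ countBelow-+ l (periodIs (l ∷ L)) ⟩
  countBelow l (periodIs (l ∷ L)) + countBelow (sum L) (periodIs (l ∷ L) ∘ (l +_))
    ≡⟨ cong₂ _+_ (countBelow-constant l (λ r<l → cong isK (canonical-period-head L r<l l≤B)))
                 (countF-cong {sum L} (λ x → cong isK (canonical-period-tail B l L (toℕ x)))) ⟩
  (if does (l ℕ.≟ k) then l else 0) + countBelow (sum L) (periodIs L)
    ≡⟨ cong ((if does (l ℕ.≟ k) then l else 0) +_) (canonical-period-count k L L≤B) ⟩
  (if does (l ℕ.≟ k) then l else 0) + k * multiplicity k L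
    ≡⟨ head (l ℕ.≟ k) ⟩
  k * multiplicity k (l ∷ L) ∎
  where
  isK : ℕ → Bool
  isK p = does (p ℕ.≟ k)
  periodIs : List ℕ → ℕ → Bool
  periodIs L j = isK (period ℕ._≟_ B (canonical L) j)
  head : (l≟k : Dec (l ≡ k)) → (if does l≟k then l else 0) + k * multiplicity k L
                                 ≡ k * ((if does l≟k then 1 else 0) + multiplicity k L)
  head (yes refl) = sym (*-suc l _)
  head (no _)     = refl

multiplicity-self : ∀ k L → multiplicity k (k ∷ L) ≡ suc (multiplicity k L)
multiplicity-self k L rewrite dec-true (k ℕ.≟ k) refl = refl

multiplicity-above : ∀ {a k L} → All (_≤ a) L → a < k → multiplicity k L ≡ 0
multiplicity-above []          a<k = refl
multiplicity-above (l≤a ∷ L≤a) a<k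
  rewrite dec-false (_ ℕ.≟ _) (λ l≡k → <-irrefl l≡k (≤-<-trans l≤a a<k)) = multiplicity-above L≤a a<k

nonIncreasing-multiplicity-injective :
  ∀ {L₁ L₂} → All (1 ≤_) L₁ → All (1 ≤_) L₂ → Linked _≥_ L₁ → Linked _≥_ L₂ →
  (∀ k → 1 ≤ k → multiplicity k L₁ ≡ multiplicity k L₂) → L₁ ≡ L₂
nonIncreasing-multiplicity-injective {[]}     {[]}     _ _ _ _ same = refl
nonIncreasing-multiplicity-injective {[]}     {b ∷ L₂} _ (1≤b ∷ _) _ _ same =
  contradiction (trans (same b 1≤b) (multiplicity-self b L₂)) λ ()
nonIncreasing-multiplicity-injective {a ∷ L₁} {[]}     (1≤a ∷ _) _ _ _ same =
  contradiction (trans (sym (same a 1≤a)) (multiplicity-self a L₁)) λ ()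
nonIncreasing-multiplicity-injective {a ∷ L₁} {b ∷ L₂} (1≤a ∷ pos₁) (1≤b ∷ pos₂) dec₁ dec₂ same
  with <-cmp a b
... | tri< a<b _ _  = contradiction (trans (sym (multiplicity-above (Linked⇒All (flip ≤-trans) ≤-refl dec₁) a<b))
                                           (trans (same b 1≤b) (multiplicity-self b L₂))) λ ()
... | tri> _ _ b<a  = contradiction (trans (sym (multiplicity-above (Linked⇒All (flip ≤-trans) ≤-refl dec₂) b<a))
                                           (trans (sym (same a 1≤a)) (multiplicity-self a L₁))) λ ()
... | tri≈ _ refl _ = cong (a ∷_) (nonIncreasing-multiplicity-injective pos₁ pos₂ (Linked.tail dec₁) (Linked.tail dec₂)
                                     λ k 1≤k → +-cancelˡ-≡ _ _ _ (same k 1≤k))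

-- Cycle decomposition

imageBelow : ∀ {n} → ℕ → (ℕ → Fin n) → Fin n → Bool
imageBelow zero    e y = false
imageBelow (suc k) e y = does (e k ≟ᶠ y) ∨ imageBelow k e y

imageBelow⇒ : ∀ {n k} {e : ℕ → Fin n} {y} → imageBelow k e y ≡ true → ∃[ i ] i < k × e i ≡ y
imageBelow⇒ {k = suc k} {e} {y} hit with e k ≟ᶠ y
... | yes ek≡y = k , ≤-refl , ek≡y
... | no  _    with i , i<k , ei≡y ← imageBelow⇒ hit = i , m<n⇒m<1+n i<k , ei≡y

imageBelow-hit : ∀ {n k} (e : ℕ → Fin n) {i} → i < k → imageBelow k e (e i) ≡ true
imageBelow-hit {k = suc k} e {i} i<1+k with e k ≟ᶠ e i | m<1+n⇒m<n∨m≡n i<1+k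
... | yes _    | _         = refl
... | no  _    | inj₁ i<k  = imageBelow-hit e i<k
... | no ek≢ei | inj₂ refl = contradiction refl ek≢ei

countF-imageBelow : ∀ {n} k {e : ℕ → Fin n} → InjectiveBelow k e → countF (imageBelow k e) ≡ k
countF-imageBelow {n} zero    _           = countF-none {n} (λ _ → refl)
countF-imageBelow     (suc k) {e} e-inj = begin
  countF (imageBelow (suc k) e)              ≡⟨ countF-remove (imageBelow (suc k) e) (imageBelow-hit e (n<1+n k)) ⟩
  suc (countF (imageBelow (suc k) e ∖ e k))  ≡⟨ cong suc (countF-cong drop-last) ⟩
  suc (countF (imageBelow k e))              ≡⟨ cong suc (countF-imageBelow k (λ i<k j<k → e-inj (lift i<k) (lift j<k))) ⟩
  suc k                                      ∎
  where
  lift : ∀ {i} → i < k → i < suc k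
  lift = m<n⇒m<1+n
  drop-last : ∀ y → (imageBelow (suc k) e ∖ e k) y ≡ imageBelow k e y
  drop-last y with y ≟ᶠ e k
  ... | no y≢ek rewrite dec-false (e k ≟ᶠ y) (y≢ek ∘ sym) = ∧-identityʳ _
  ... | yes refl with imageBelow k e (e k) in hit
  ...   | false = ∧-zeroʳ _
  ...   | true  with i , i<k , ei≡ek ← imageBelow⇒ hit = contradiction (e-inj (lift i<k) ≤-refl ei≡ek) (<⇒≢ i<k)

module CycleDecomposition {m : ℕ} {π : Fin (suc m) → Fin (suc m)} (π-inj : Injective _≡_ _≡_ π) where

  per : Fin (suc m) → ℕ
  per = period _≟ᶠ_ (suc m) π

  per-minimal : ∀ x → MinimalPeriod π x (per x)
  per-minimal x = proj₁ (period-spec π-inj x)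

  orbit : Fin (suc m) → Fin (suc m) → Bool
  orbit x = imageBelow (per x) λ i → (π ^ i) x

  orbit⇒ : ∀ x {y} → orbit x y ≡ true → ∃[ i ] i < per x × (π ^ i) x ≡ y
  orbit⇒ x = imageBelow⇒ {k = per x} {e = λ i → (π ^ i) x}

  orbit-hit : ∀ x {i} → i < per x → orbit x ((π ^ i) x) ≡ true
  orbit-hit x = imageBelow-hit {k = per x} (λ i → (π ^ i) x)

  orbit-pred : ∀ x {y} → orbit x (π y) ≡ true → orbit x y ≡ true
  orbit-pred x {y} πy∈ with orbit⇒ x πy∈
  ... | suc i , i<per , eq = subst (λ z → orbit x z ≡ true) (π-inj eq) (orbit-hit x (<-trans (n<1+n i) i<per))
  ... | zero  , _     , eq = subst (λ z → orbit x z ≡ true) (π-inj (trans (MinimalPeriod.returns (per-minimal x)) eq))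
                                   (orbit-hit x (n<1+n _))

  Closed : (Fin (suc m) → Bool) → Set
  Closed S = ∀ y → S y ≡ true → S (π y) ≡ true

  ^-closed : ∀ {S} → Closed S → ∀ {x} → S x ≡ true → ∀ i → S ((π ^ i) x) ≡ true
  ^-closed     closed x∈ zero    = x∈
  ^-closed {S} closed x∈ (suc i) = closed _ (^-closed {S} closed x∈ i)

  orbit⊆ : ∀ {S} → Closed S → ∀ {x y} → S x ≡ true → orbit x y ≡ true → S y ≡ true
  orbit⊆ {S} closed {x} x∈ y∈ with i , _ , πⁱx≡y ← orbit⇒ x y∈ =
    subst (λ z → S z ≡ true) πⁱx≡y (^-closed {S} closed x∈ i)

  removeOrbit : (Fin (suc m) → Bool) → Fin (suc m) → Fin (suc m) → Bool
  removeOrbit S x y = S y ∧ not (orbit x y)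

  removeOrbit⇒ : ∀ {S x y} → removeOrbit S x y ≡ true → S y ≡ true × orbit x y ≡ false
  removeOrbit⇒ {S} {x} {y} y∈ with S y | orbit x y
  ... | true | false = refl , refl

  removeOrbit-closed : ∀ {S} → Closed S → ∀ x → Closed (removeOrbit S x)
  removeOrbit-closed {S} closed x y y∈ with S y in Sy | orbit x y in oy
  ... | true | false rewrite closed y Sy with orbit x (π y) in oπy
  ...   | false = refl
  ...   | true  = contradiction (trans (sym (orbit-pred x oπy)) oy) λ ()

  removeOrbit-count : ∀ {S} → Closed S → ∀ {x} → S x ≡ true → countF S ≡ per x + countF (removeOrbit S x)
  removeOrbit-count {S} closed {x} x∈ = begin
    countF S                                                ≡⟨ countF-split S (orbit x) ⟩
    countF (λ y → S y ∧ orbit x y) + countF (removeOrbit S x) ≡⟨ cong (_+ rest) (countF-cong orbit⊆S) ⟩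
    countF (orbit x) + countF (removeOrbit S x)             ≡⟨ cong (_+ rest) (countF-imageBelow (per x) orbit-inj) ⟩
    per x + countF (removeOrbit S x)                        ∎
    where
    rest = countF (removeOrbit S x)
    orbit-inj = orbit-injective π-inj (per-minimal x)
    orbit⊆S : ∀ y → S y ∧ orbit x y ≡ orbit x y
    orbit⊆S y with orbit x y in oy
    ... | false = ∧-zeroʳ (S y)
    ... | true  = cong (_∧ true) (orbit⊆ closed x∈ oy)

  -- label is junk beyond sum cycles; the points form Fin (suc m) so that the empty decomposition has one.
  record Decomposition (S : Fin (suc m) → Bool) (bound : ℕ) : Set where
    field
      cycles          : List ℕ
      positive        : All (1 ≤_) cycles
      nonIncreasing   : Linked _≥_ (bound ∷ cycles)
      size            : sum cycles ≡ countF S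
      label           : ℕ → Fin (suc m)
      label-available : ∀ {i} → i < sum cycles → S (label i) ≡ true
      label-injective : InjectiveBelow (sum cycles) label
      label-conj      : ∀ {i} → i < sum cycles → π (label i) ≡ label (canonical cycles i)

  prepend-orbit : ∀ {S b} → Closed S → ∀ {x} → S x ≡ true → per x ≤ b →
                  Decomposition (removeOrbit S x) (per x) → Decomposition S b
  prepend-orbit {S} closed {x} x∈ per≤b D = record
    { cycles          = per x ∷ cycles
    ; positive        = s≤s z≤n ∷ positive
    ; nonIncreasing   = per≤b ∷ nonIncreasing
    ; size            = trans (cong (per x +_) size) (sym (removeOrbit-count closed x∈))
    ; label           = label′
    ; label-available = available
    ; label-injective = ++-injective {f = λ i → (π ^ i) x} (orbit-injective π-inj (per-minimal x))
                                     label-injective disjoint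
    ; label-conj      = conj
    }
    where
    open Decomposition D
    label′ : ℕ → Fin (suc m)
    label′ = (λ i → (π ^ i) x) ++[ per x ] label
    label′-orbit : ∀ {i} → i < per x → label′ i ≡ (π ^ i) x
    label′-orbit = ++-before {f = λ i → (π ^ i) x}
    label′-rest : ∀ t → label′ (per x + t) ≡ label t
    label′-rest = ++-after {f = λ i → (π ^ i) x} (per x)
    available : ∀ {i} → i < per x + sum cycles → S (label′ i) ≡ true
    available {i} i< with cut (per x) i
    ... | before i<per = subst (λ y → S y ≡ true) (sym (label′-orbit i<per)) (^-closed {S} closed x∈ i)
    ... | after t      = subst (λ y → S y ≡ true) (sym (label′-rest t))
                               (proj₁ (removeOrbit⇒ {S} (label-available (+-cancelˡ-< (per x) t _ i<))))
    disjoint : ∀ {i j} → i < per x → j < sum cycles → (π ^ i) x ≢ label j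
    disjoint i<per j< eq = contradiction (trans (sym (orbit-hit x i<per)) (subst (λ y → orbit x y ≡ false) (sym eq)
                                                   (proj₂ (removeOrbit⇒ {S} (label-available j<))))) λ ()
    conj : ∀ {i} → i < per x + sum cycles → π (label′ i) ≡ label′ (canonical (per x ∷ cycles) i)
    conj {i} i< with cut (per x) i
    ... | before i<per = begin
      π (label′ i)                          ≡⟨ cong π (label′-orbit i<per) ⟩
      (π ^ suc i) x                         ≡⟨ next (m≤n⇒m<n∨m≡n i<per) ⟩
      label′ (rotate (per x) i)             ≡⟨ cong label′ (canonical-head cycles i<per) ⟨
      label′ (canonical (per x ∷ cycles) i) ∎
      where
      next : suc i < per x ⊎ suc i ≡ per x → (π ^ suc i) x ≡ label′ (rotate (per x) i)
      next (inj₁ 1+i<per) = sym (trans (cong label′ (rotate-step 1+i<per)) (label′-orbit 1+i<per))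
      next (inj₂ 1+i≡per) = begin
        (π ^ suc i) x              ≡⟨ cong (λ e → (π ^ e) x) 1+i≡per ⟩
        (π ^ per x) x              ≡⟨ MinimalPeriod.returns (per-minimal x) ⟩
        x                          ≡⟨ label′-orbit (s≤s z≤n) ⟨
        label′ 0                   ≡⟨ cong label′ (rotate-last 1+i≡per) ⟨
        label′ (rotate (per x) i)  ∎
    ... | after t = begin
      π (label′ (per x + t))                           ≡⟨ cong π (label′-rest t) ⟩
      π (label t)                                      ≡⟨ label-conj (+-cancelˡ-< (per x) t _ i<) ⟩
      label (canonical cycles t)                       ≡⟨ label′-rest _ ⟨
      label′ (per x + canonical cycles t)              ≡⟨ cong label′ (canonical-tail (per x) cycles t) ⟨
      label′ (canonical (per x ∷ cycles) (per x + t))  ∎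

  -- Split off the orbit of an available point of longest period, so cycle lengths never increase.
  decompose : ∀ fuel {S} → countF S ≤ fuel → Closed S → ∀ {b} → (∀ y → S y ≡ true → per y ≤ b) →
              Decomposition S b
  decompose fuel {S} small closed bounded with argmax S per
  ... | inj₁ none = record
    { cycles = [] ; positive = [] ; nonIncreasing = [-] ; size = sym (countF-none none)
    ; label = λ _ → zero ; label-available = λ () ; label-injective = λ () ; label-conj = λ () }
  ... | inj₂ (x , x∈ , longest) with fuel
  ...   | zero     = contradiction (subst (_≤ 0) (countF-remove S x∈) small) λ ()
  ...   | suc fuel = prepend-orbit closed x∈ (bounded x x∈)
                       (decompose fuel smaller (removeOrbit-closed closed x)
                                  λ y y∈ → longest y (proj₁ (removeOrbit⇒ {S} y∈)))
    where
    smaller : countF (removeOrbit S x) ≤ fuel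
    smaller = s≤s⁻¹ (≤-trans (+-monoˡ-≤ _ (MinimalPeriod.positive (per-minimal x)))
                             (≤-trans (≤-reflexive (sym (removeOrbit-count {S} closed x∈))) small))

-- Periods as conjugacy invariants

module _ {m : ℕ} (p : Partition m) where

  toℕ<sum : ∀ (x : Fin m) → toℕ x < sum (parts p)
  toℕ<sum x = subst (toℕ x <_) (sym (total p)) (toℕ<n x)

  permutationOfType : Fin m → Fin m
  permutationOfType x =
    fromℕ< (subst (canonical (parts p) (toℕ x) <_) (total p) (canonical-below (parts p) (toℕ<sum x)))

  toℕ-permutationOfType : ∀ x → toℕ (permutationOfType x) ≡ canonical (parts p) (toℕ x)
  toℕ-permutationOfType x = toℕ-fromℕ< _

  permutationOfType-injective : Injective _≡_ _≡_ permutationOfType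
  permutationOfType-injective {x} {y} eq = toℕ-injective (canonical-injective (parts p) (toℕ<sum x) (toℕ<sum y)
    (trans (sym (toℕ-permutationOfType x)) (trans (cong toℕ eq) (toℕ-permutationOfType y))))

periodCount : ∀ {m} → (Fin m → Fin m) → ℕ → ℕ
periodCount {m} π k = countF (λ x → does (period _≟ᶠ_ m π x ℕ.≟ k))

periodCount-conj : ∀ {m} {π₁ π₂ τ : Fin m → Fin m} → Injective _≡_ _≡_ τ → (∀ x → τ (π₁ x) ≡ π₂ (τ x)) →
                   ∀ k → periodCount π₁ k ≡ periodCount π₂ k
periodCount-conj {m} {π₁} {π₂} {τ} τ-inj conj k with σ , σ≗τ ← injective⇒permutation τ-inj = begin
  periodCount π₁ k                   ≡⟨ countF-cong (λ x → cong isK (sym (same x))) ⟩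
  countF (λ x → isK (per₂ (σ ⟨$⟩ʳ x))) ≡⟨ countF-permute (isK ∘ per₂) σ ⟨
  periodCount π₂ k                   ∎
  where
  isK : ℕ → Bool
  isK p = does (p ℕ.≟ k)
  per₂ : Fin m → ℕ
  per₂ = period _≟ᶠ_ m π₂
  same : ∀ x → per₂ (σ ⟨$⟩ʳ x) ≡ period _≟ᶠ_ m π₁ x
  same x = trans (cong per₂ (σ≗τ x)) (period-conj _≟ᶠ_ _≟ᶠ_ {π₁} {π₂} {τ} τ-inj conj m x)

parts≤sum : ∀ L → All (_≤ sum L) L
parts≤sum []      = []
parts≤sum (l ∷ L) = m≤m+n l (sum L) ∷ All.map (λ k≤ → ≤-trans k≤ (m≤n+m (sum L) l)) (parts≤sum L)

periodCount-permutationOfType : ∀ {m} (p : Partition m) k →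
                                periodCount (permutationOfType p) k ≡ k * multiplicity k (parts p)
periodCount-permutationOfType {m} p k = begin
  periodCount (permutationOfType p) k
    ≡⟨ countF-cong (λ x → cong isK (sym (period-conj _≟ᶠ_ ℕ._≟_ {permutationOfType p} {canonical (parts p)} {toℕ}
                                           toℕ-injective (toℕ-permutationOfType p) m x))) ⟩
  countBelow m canonicalPeriodIsK
    ≡⟨ cong (λ s → countBelow s canonicalPeriodIsK) (total p) ⟨
  countBelow (sum (parts p)) canonicalPeriodIsK
    ≡⟨ canonical-period-count k (parts p) (subst (λ s → All (_≤ s) (parts p)) (total p) (parts≤sum (parts p))) ⟩
  k * multiplicity k (parts p) ∎
  where
  isK : ℕ → Bool
  isK p = does (p ℕ.≟ k)
  canonicalPeriodIsK : ℕ → Bool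
  canonicalPeriodIsK j = isK (period ℕ._≟_ m (canonical (parts p)) j)

conjugate-types-equal : ∀ {m} (p q : Partition m) {τ : Fin m → Fin m} → Injective _≡_ _≡_ τ →
                        (∀ x → τ (permutationOfType p x) ≡ permutationOfType q (τ x)) → parts p ≡ parts q
conjugate-types-equal p q τ-inj conj =
  nonIncreasing-multiplicity-injective (pos p) (pos q) (nonInc p) (nonInc q) λ { (suc k) _ →
    *-cancelˡ-≡ _ _ (suc k) (begin
      suc k * multiplicity (suc k) (parts p)     ≡⟨ periodCount-permutationOfType p (suc k) ⟨
      periodCount (permutationOfType p) (suc k)  ≡⟨ periodCount-conj {π₂ = permutationOfType q} τ-inj conj (suc k) ⟩
      periodCount (permutationOfType q) (suc k)  ≡⟨ periodCount-permutationOfType q (suc k) ⟩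
      suc k * multiplicity (suc k) (parts q)     ∎) }

-- Cones over permutations

cone : ∀ {m} → (Fin m → Fin m) → Digraph (suc m)
cone π zero    zero    = false
cone π zero    (suc j) = true
cone π (suc i) zero    = false
cone π (suc i) (suc j) = does (j ≟ᶠ π i)

module Cone {m : ℕ} {π : Fin m → Fin m} (π-inj : Injective _≡_ _≡_ π) where

  preimage : Fin m → Fin m
  preimage j = proj₁ (injective⇒surjective π-inj j)

  π-preimage : ∀ j → π (preimage j) ≡ j
  π-preimage j = proj₂ (injective⇒surjective π-inj j)

  arc-preimage : ∀ j → cone π (suc (preimage j)) (suc j) ≡ true
  arc-preimage j = dec-true (j ≟ᶠ _) (sym (π-preimage j))

  indeg-zero : indeg (cone π) zero ≡ 0
  indeg-zero = countF-none {m} λ _ → refl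

  indeg-suc : ∀ j → indeg (cone π) (suc j) ≡ 2
  indeg-suc j = cong suc (countF-single (arc-preimage j)
    λ i ji → π-inj (trans (sym (does-true⇒ (j ≟ᶠ π i) ji)) (sym (π-preimage j))))

  outdeg-suc : ∀ i → outdeg (cone π) (suc i) ≡ 1
  outdeg-suc i = countF-single (dec-true (π i ≟ᶠ π i) refl) λ j ji → does-true⇒ (j ≟ᶠ π i) ji

  source⇒zero : ∀ x → IsSource (cone π) x → x ≡ zero
  source⇒zero zero    _   = refl
  source⇒zero (suc j) src = contradiction (trans (sym (indeg-suc j)) src) λ ()

  -- Each indeg (cone π) (suc j) computes to a successor, so the rest of the count is countF (λ _ → false),
  -- which is also what indeg (cone π) zero computes to.
  numSources-cone : numSources (cone π) ≡ 1
  numSources-cone rewrite indeg-zero = refl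

  connected : WeaklyConnected (cone π)
  connected x y = via-zero x (from-zero y)
    where
    from-zero : ∀ y → UConn (cone π) zero y
    from-zero zero    = here
    from-zero (suc j) = fwd refl here
    via-zero : ∀ x → UConn (cone π) zero y → UConn (cone π) x y
    via-zero zero    c = c
    via-zero (suc i) c = bwd refl c

  cone-SG1 : 1 ≤ m → SG1 (suc m)
  cone-SG1 1≤m = cone π , (outdeg-pos , connected , s1 , s2 , s3) , numSources-cone
    where
    outdeg-pos : OutdegPos (cone π)
    outdeg-pos zero    = subst (1 ≤_) (sym (countF-const-true m)) 1≤m
    outdeg-pos (suc i) = subst (1 ≤_) (sym (outdeg-suc i)) ≤-refl
    s1 : S1 (cone π)
    s1 = (zero , indeg-zero) , λ where
      v (suc j) src _ → indeg-suc j
      v zero    src a → contradiction (subst (λ u → cone π u zero ≡ true) (source⇒zero v src) a) λ ()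
    s2 : S2 (cone π)
    s2 u v _ su sv u≢v _ _ = u≢v (trans (source⇒zero u su) (sym (source⇒zero v sv)))
    s3 : S3 (cone π)
    s3 zero    nonsrc = contradiction indeg-zero nonsrc
    s3 (suc i) _      = outdeg-suc i , indeg-suc i , zero , suc (preimage i) , refl , indeg-zero ,
                        arc-preimage i , λ src → contradiction (trans (sym (indeg-suc (preimage i))) src) λ ()

cone-iso⇒conjugate : ∀ {m} {π₁ π₂ : Fin m → Fin m} → Iso (cone π₁) (cone π₂) →
                     ∃[ τ ] Injective _≡_ _≡_ τ × (∀ x → τ (π₁ x) ≡ π₂ (τ x))
cone-iso⇒conjugate {m} {π₁} {π₂} (σ , arcs) = (ρ ⟨$⟩ʳ_) , ρ-injective , conj
  where
  no-arc-to-zero : ∀ x → cone π₂ x zero ≡ false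
  no-arc-to-zero zero    = refl
  no-arc-to-zero (suc _) = refl
  σ-zero : σ ⟨$⟩ʳ zero ≡ zero
  σ-zero with σ ⟨$⟩ˡ zero in σ⁻¹0
  ... | zero  = trans (cong (σ ⟨$⟩ʳ_) (sym σ⁻¹0)) (inverseʳ σ)
  ... | suc i = contradiction (begin
    true                                          ≡⟨ arcs zero (suc i) ⟩
    cone π₂ (σ ⟨$⟩ʳ zero) (σ ⟨$⟩ʳ suc i)          ≡⟨ cong (λ y → cone π₂ (σ ⟨$⟩ʳ zero) (σ ⟨$⟩ʳ y)) σ⁻¹0 ⟨
    cone π₂ (σ ⟨$⟩ʳ zero) (σ ⟨$⟩ʳ (σ ⟨$⟩ˡ zero))  ≡⟨ cong (cone π₂ (σ ⟨$⟩ʳ zero)) (inverseʳ σ) ⟩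
    cone π₂ (σ ⟨$⟩ʳ zero) zero                    ≡⟨ no-arc-to-zero (σ ⟨$⟩ʳ zero) ⟩
    false                                         ∎) λ ()
  ρ : Permutation′ m
  ρ = remove zero σ
  σ-suc : ∀ i → σ ⟨$⟩ʳ suc i ≡ suc (ρ ⟨$⟩ʳ i)
  σ-suc i = sym (lift₀-remove σ σ-zero (suc i))
  ρ-injective : Injective _≡_ _≡_ (ρ ⟨$⟩ʳ_)
  ρ-injective eq = trans (sym (inverseˡ ρ)) (trans (cong (ρ ⟨$⟩ˡ_) eq) (inverseˡ ρ))
  conj : ∀ x → ρ ⟨$⟩ʳ π₁ x ≡ π₂ (ρ ⟨$⟩ʳ x)
  conj x = does-true⇒ (ρ ⟨$⟩ʳ π₁ x ≟ᶠ π₂ (ρ ⟨$⟩ʳ x)) (begin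
    does (ρ ⟨$⟩ʳ π₁ x ≟ᶠ π₂ (ρ ⟨$⟩ʳ x))         ≡⟨ cong₂ (cone π₂) (σ-suc x) (σ-suc (π₁ x)) ⟨
    cone π₂ (σ ⟨$⟩ʳ suc x) (σ ⟨$⟩ʳ suc (π₁ x))  ≡⟨ arcs (suc x) (suc (π₁ x)) ⟨
    does (π₁ x ≟ᶠ π₁ x)                          ≡⟨ dec-true (π₁ x ≟ᶠ π₁ x) refl ⟩
    true                                         ∎)

-- One-source star-generating digraphs are cones

module OneSource {m : ℕ} {G : Digraph (suc m)}
                 (outdeg-pos : OutdegPos G) (s1 : S1 G) (s3 : S3 G) (one-source : numSources G ≡ 1) where

  s : Fin (suc m)
  s = proj₁ (proj₁ s1)

  s-source : IsSource G s
  s-source = proj₂ (proj₁ s1)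

  source-unique : ∀ x → IsSource G x → x ≡ s
  source-unique x x-src =
    countF≡1⇒unique {p = λ v → indeg G v ℕ.≡ᵇ 0} one-source (flagged x-src) (flagged s-source)
    where
    flagged : ∀ {v} → IsSource G v → (indeg G v ℕ.≡ᵇ 0) ≡ true
    flagged src rewrite src = refl

  nonSource : ∀ {x} → x ≢ s → ¬ IsSource G x
  nonSource x≢s = x≢s ∘ source-unique _

  source-arc : ∀ {x} → x ≢ s → G s x ≡ true
  source-arc {x} x≢s with _ , _ , s′ , _ , s′x , s′-src , _ ← s3 x (nonSource x≢s) =
    subst (λ v → G v x ≡ true) (source-unique s′ s′-src) s′x

  no-arc-to-source : ∀ x → G x s ≡ false
  no-arc-to-source = countF≡0⇒ (λ v → G v s) s-source

  prey-exists : ∀ x → ∃[ y ] G x y ≡ true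
  prey-exists x with any? (λ y → G x y ≟ᵇ true)
  ... | yes hit   = hit
  ... | no  empty = contradiction (subst (1 ≤_) (countF-none {p = G x} none) (outdeg-pos x)) λ ()
    where
    none : ∀ y → G x y ≡ false
    none y with G x y in xy
    ... | false = refl
    ... | true  = contradiction (y , xy) empty

  -- Sending s to itself makes prey a permutation of all the vertices.
  prey : Fin (suc m) → Fin (suc m)
  prey x with x ≟ᶠ s
  ... | yes _ = s
  ... | no  _ = proj₁ (prey-exists x)

  prey-source : prey s ≡ s
  prey-source with s ≟ᶠ s
  ... | yes _   = refl
  ... | no  s≢s = contradiction refl s≢s

  prey-arc : ∀ {x} → x ≢ s → G x (prey x) ≡ true
  prey-arc {x} x≢s with x ≟ᶠ s
  ... | yes x≡s = contradiction x≡s x≢s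
  ... | no  _   = proj₂ (prey-exists x)

  prey-unique : ∀ {x y} → x ≢ s → G x y ≡ true → y ≡ prey x
  prey-unique {x} x≢s xy = countF≡1⇒unique (proj₁ (s3 x (nonSource x≢s))) xy (prey-arc x≢s)

  prey≢source : ∀ {x} → x ≢ s → prey x ≢ s
  prey≢source {x} x≢s prey≡s =
    contradiction (trans (sym (no-arc-to-source x)) (subst (λ y → G x y ≡ true) prey≡s (prey-arc x≢s))) λ ()

  -- A common prey z of a ≢ s and b ≢ s has the predators s, a and b, but indegree 2.
  prey-injective : Injective _≡_ _≡_ prey
  prey-injective {a} {b} eq = by-cases (a ≟ᶠ s) (b ≟ᶠ s)
    where
    by-cases : Dec (a ≡ s) → Dec (b ≡ s) → a ≡ b
    by-cases (yes a≡s) (yes b≡s) = trans a≡s (sym b≡s)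
    by-cases (yes a≡s) (no  b≢s) =
      contradiction (trans (sym eq) (trans (cong prey a≡s) prey-source)) (prey≢source b≢s)
    by-cases (no  a≢s) (yes b≡s) =
      contradiction (trans eq (trans (cong prey b≡s) prey-source)) (prey≢source a≢s)
    by-cases (no  a≢s) (no  b≢s) =
      countF≡1⇒unique {p = predator ∖ s} one-other-predator (other-predator a≢s refl) (other-predator b≢s (sym eq))
      where
      z = prey a
      predator : Fin (suc m) → Bool
      predator v = G v z
      one-other-predator : countF (predator ∖ s) ≡ 1
      one-other-predator = suc-injective (trans (sym (countF-remove predator (source-arc (prey≢source a≢s))))
                                                (proj₁ (proj₂ (s3 z (nonSource (prey≢source a≢s))))))
      other-predator : ∀ {v} → v ≢ s → prey v ≡ z → (predator ∖ s) v ≡ true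
      other-predator {v} v≢s preyv≡z rewrite sym preyv≡z | prey-arc v≢s | dec-false (v ≟ᶠ s) v≢s = refl

  cone-iso : ∀ {π : Fin m → Fin m} {τ : Fin (suc m) → Fin (suc m)} → Injective _≡_ _≡_ τ → τ zero ≡ s →
             (∀ i → τ (suc (π i)) ≡ prey (τ (suc i))) → Iso (cone π) G
  cone-iso {π} {τ} τ-inj τ0≡s τ-conj with σ , σ≗τ ← injective⇒permutation τ-inj =
    σ , λ x y → trans (arcs x y) (sym (cong₂ G (σ≗τ x) (σ≗τ y)))
    where
    τsuc≢s : ∀ i → τ (suc i) ≢ s
    τsuc≢s i eq = contradiction (τ-inj (trans eq (sym τ0≡s))) λ ()
    arcs : ∀ x y → cone π x y ≡ G (τ x) (τ y)
    arcs zero    zero    = sym (trans (cong (G (τ zero)) τ0≡s) (no-arc-to-source _))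
    arcs zero    (suc j) = sym (trans (cong (λ v → G v (τ (suc j))) τ0≡s) (source-arc (τsuc≢s j)))
    arcs (suc i) zero    = sym (trans (cong (G (τ (suc i))) τ0≡s) (no-arc-to-source _))
    arcs (suc i) (suc j) with j ≟ᶠ π i
    ... | yes refl = sym (trans (cong (G (τ (suc i))) (τ-conj i)) (prey-arc (τsuc≢s i)))
    ... | no  j≢πi with G (τ (suc i)) (τ (suc j)) in arc
    ...   | false = refl
    ...   | true  = contradiction (sucᶠ-injective (τ-inj (trans (prey-unique (τsuc≢s i) arc) (sym (τ-conj i))))) j≢πi

  open CycleDecomposition prey-injective

  nonSourceVertex : Fin (suc m) → Bool
  nonSourceVertex = (λ _ → true) ∖ s

  nonSourceVertex⇒≢ : ∀ {y} → nonSourceVertex y ≡ true → y ≢ s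
  nonSourceVertex⇒≢ y∈ refl rewrite dec-true (s ≟ᶠ s) refl = contradiction y∈ λ ()

  nonSourceVertex-closed : Closed nonSourceVertex
  nonSourceVertex-closed y y∈ = cong not (dec-false (prey y ≟ᶠ s) (prey≢source {y} (nonSourceVertex⇒≢ y∈)))

  count-nonSourceVertex : countF nonSourceVertex ≡ m
  count-nonSourceVertex =
    suc-injective (trans (sym (countF-remove (λ _ → true) {s} refl)) (countF-const-true (suc m)))

  decomposition : Decomposition nonSourceVertex (suc m)
  decomposition = decompose (suc m) (≤-trans (≤-reflexive count-nonSourceVertex) (n≤1+n m)) nonSourceVertex-closed
                            λ y _ → proj₂ (period-spec prey-injective y)

  open Decomposition decomposition

  type : Partition m
  type = record { parts = cycles ; pos = positive ; nonInc = Linked.tail nonIncreasing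
                ; total = trans size count-nonSourceVertex }

  relabel : Fin (suc m) → Fin (suc m)
  relabel zero    = s
  relabel (suc i) = label (toℕ i)

  relabel-injective : Injective _≡_ _≡_ relabel
  relabel-injective {zero}  {zero}  _  = refl
  relabel-injective {zero}  {suc j} eq = contradiction (sym eq) (nonSourceVertex⇒≢ (label-available (toℕ<sum type j)))
  relabel-injective {suc i} {zero}  eq = contradiction eq (nonSourceVertex⇒≢ (label-available (toℕ<sum type i)))
  relabel-injective {suc i} {suc j} eq =
    cong suc (toℕ-injective (label-injective (toℕ<sum type i) (toℕ<sum type j) eq))

  relabel-conj : ∀ i → relabel (suc (permutationOfType type i)) ≡ prey (relabel (suc i))
  relabel-conj i = begin
    label (toℕ (permutationOfType type i))  ≡⟨ cong label (toℕ-permutationOfType type i) ⟩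
    label (canonical cycles (toℕ i))        ≡⟨ label-conj (toℕ<sum type i) ⟨
    prey (label (toℕ i))                    ∎

  cone-type-iso : Iso (cone (permutationOfType type)) G
  cone-type-iso = cone-iso relabel-injective refl relabel-conj

theorem3p2 : (n : ℕ) → 2 ≤ n →
    Σ (Partition (n ∸ 1) → SG1 n) (λ f →
      ((G : SG1 n) → ∃[ p ] Iso (proj₁ (f p)) (proj₁ G))
      × ((p q : Partition (n ∸ 1)) → Iso (proj₁ (f p)) (proj₁ (f q)) → parts p ≡ parts q))
theorem3p2 (suc (suc k)) (s≤s (s≤s z≤n)) = coneOfType , reached , types-determined
  where
  coneOfType : Partition (suc k) → SG1 (suc (suc k))
  coneOfType p = Cone.cone-SG1 (permutationOfType-injective p) (s≤s z≤n)
  reached : (G : SG1 (suc (suc k))) → ∃[ p ] Iso (cone (permutationOfType p)) (proj₁ G)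
  reached (G , (outdeg-pos , _ , s1 , _ , s3) , one) = type , cone-type-iso
    where open OneSource outdeg-pos s1 s3 one
  types-determined : (p q : Partition (suc k)) →
                     Iso (cone (permutationOfType p)) (cone (permutationOfType q)) → parts p ≡ parts q
  types-determined p q iso with τ , τ-inj , conj ← cone-iso⇒conjugate iso = conjugate-types-equal p q τ-inj conj
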